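{- Let $H$ be an ordered graph on $h$ vertices, let $r:=\chi_<(H)$, and let $\mathcal C$ be the set of interval $r$-colourings of $H$. Define $\ell_-(H):=\max_{(H_1<\dots<H_r)\in\mathcal C}|H_1|$ and $\ell^*_-(H):=\max_{(H_1<\dots<H_r)\in\mathcal C}|H_r|$. Then $\chi^*_{cr}(H)\geq h/\ell_-(H)$ and $\chi^*_{cr}(H)\geq h/\ell^*_-(H)$.
   Context: An ordered graph on $h$ vertices is a graph with vertex set $[h]$ (ordered naturally); an ordered graph $G$ contains $H$ if there is an order-preserving injection $V(H)\to V(G)$ mapping edges to edges. For sets of integers, $X<Y$ means $a<b$ for all $a\in X,b\in Y$. An interval $r$-colouring of $H$ is a partition of $[h]$ into $r$ intervals $H_1<\dots<H_r$ with no edge inside any interval; $\chi_<(H)$ is the least such $r$. An $H$-tiling is a collection of vertex-disjoint copies of $H$; perfect if it covers all vertices. For a complete $k$-partite unordered graph $B$ with parts $U_1,\dots,U_k$ and a permutation $\sigma$ of $[k]$, an interval labelling w.r.t. $\sigma$ is a bijection $\phi:V(B)\to[|B|]$ with $\phi(U_i)<\phi(U_j)$ when $\sigma(i)<\sigma(j)$; the ordered blow-up $(B(t),\phi)$ replaces each vertex $x$ by $t$ independent vertices $V_x$ (complete bipartite between $V_x,V_y$ when $xy\in E(B)$) ordered so that $V_x<V_y$ when $\phi(x)<\phi(y)$. $B$ is a bottlegraph of $H$ if for every such $\sigma,\phi$ there is $t$ with $(B(t),\phi)$ containing a perfect $H$-tiling. $\chi_{cr}(F)=(\chi(F)-1)|F|/(|F|-\sigma(F))$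 for unordered $F$, with $\sigma(F)$ the least size of a colour class over proper $\chi(F)$-colourings; $\chi^*_{cr}(H)=\inf\{\chi_{cr}(B): B \text{ a bottlegraph of } H\}$. -}

module Defs where

open import Data.Nat using (ℕ; zero; suc; _+_; _*_; _∸_; _≤_)
import Data.Nat as ℕ
open import Data.Nat.Properties using () renaming (_≟_ to _≟ℕ_)
open import Data.Fin using (Fin; toℕ; _<_)
open import Data.Fin.Properties using (_≟_)
open import Data.Fin.Permutation using (Permutation′; _⟨$⟩ʳ_)
open import Data.List using (List; length; filter; allFin)
open import Data.Product using (Σ; ∃; _×_; _,_)
open import Data.Sum using (_⊎_)
open import Relation.Nullary using (¬_)
open import Relation.Binary.PropositionalEquality using (_≡_; _≢_)

-- Simple graphs on vertex set Fin n (symmetric, irreflexive edge relation).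
-- An *ordered* graph on h vertices is a Graph h with vertex set
-- Fin h = [h] ordered naturally (Data.Fin._<_).

record Graph (n : ℕ) : Set₁ where
  field
    E      : Fin n → Fin n → Set
    sym    : ∀ {x y} → E x y → E y x
    irrefl : ∀ {x} → ¬ E x x
open Graph public

classSize : ∀ {n k} → (Fin n → Fin k) → ℕ → ℕ
classSize {n} c i = length (filter (λ x → toℕ (c x) ≟ℕ i) (allFin n))

-- An interval r-colouring H₁ < ... < Hᵣ is encoded by the map
-- c : [h] → [r] sending a vertex to the index of its interval: c is
-- monotone (so the parts are intervals with H₁ < ... < Hᵣ), surjective
-- (the parts are non-empty, i.e. a partition into r intervals), and no edge
-- lies inside a part.

record IntervalColouring {h : ℕ} (H : Graph h) (r : ℕ) : Set where
  field
    col      : Fin h → Fin r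
    monotone : ∀ x y → x < y → toℕ (col x) ≤ toℕ (col y)
    onto     : ∀ i → ∃ λ x → col x ≡ i
    proper   : ∀ x y → E H x y → col x ≢ col y
open IntervalColouring public

IsIntervalChromatic : ∀ {h} → Graph h → ℕ → Set
IsIntervalChromatic H r =
  IntervalColouring H r × (∀ s → s ℕ.< r → ¬ IntervalColouring H s)

firstSize : ∀ {h} {H : Graph h} {r} → IntervalColouring H r → ℕ
firstSize c = classSize (col c) 0

lastSize : ∀ {h} {H : Graph h} {r} → IntervalColouring H r → ℕ
lastSize {r = r} c = classSize (col c) (r ∸ 1)

IsMaxOver : ∀ {h} (H : Graph h) (r : ℕ) →
            (IntervalColouring H r → ℕ) → ℕ → Set
IsMaxOver H r f ℓ =
  (∃ λ c → f c ≡ ℓ) × (∀ c → f c ≤ ℓ)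

IsEllMinus : ∀ {h} → Graph h → ℕ → Set
IsEllMinus H ℓ = Σ ℕ λ r → IsIntervalChromatic H r × IsMaxOver H r firstSize ℓ

IsEllMinusStar : ∀ {h} → Graph h → ℕ → Set
IsEllMinusStar H ℓ = Σ ℕ λ r → IsIntervalChromatic H r × IsMaxOver H r lastSize ℓ

IsProperColouring : ∀ {n} → Graph n → (k : ℕ) → (Fin n → Fin k) → Set
IsProperColouring F k c = ∀ x y → E F x y → c x ≢ c y

IsChromaticNumber : ∀ {n} → Graph n → ℕ → Set
IsChromaticNumber F k =
  (∃ λ c → IsProperColouring F k c) ×
  (∀ j → j ℕ.< k → ∀ c → ¬ IsProperColouring F j c)

IsSigma : ∀ {n} → Graph n → ℕ → ℕ → Set
IsSigma F k s =
  (∃ λ c → IsProperColouring F k c × ∃ λ (i : Fin k) → classSize c (toℕ i) ≡ s) ×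
  (∀ c → IsProperColouring F k c → ∀ (i : Fin k) → s ≤ classSize c (toℕ i))

record CompleteMultipartite : Set where
  field
    n    : ℕ
    k    : ℕ
    part : Fin n → Fin k
    onto : ∀ i → ∃ λ x → part x ≡ i
open CompleteMultipartite public

graphOf : (B : CompleteMultipartite) → Graph (n B)
graphOf B = record
  { E      = λ x y → part B x ≢ part B y
  ; sym    = λ ne eq → ne (Relation.Binary.PropositionalEquality.sym eq)
  ; irrefl = λ ne → ne Relation.Binary.PropositionalEquality.refl
  }

IsIntervalLabelling : (B : CompleteMultipartite) →
  Permutation′ (k B) → Permutation′ (n B) → Set
IsIntervalLabelling B σ φ =
  ∀ x y → (σ ⟨$⟩ʳ part B x) < (σ ⟨$⟩ʳ part B y) → (φ ⟨$⟩ʳ x) < (φ ⟨$⟩ʳ y)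

BVert : CompleteMultipartite → ℕ → Set
BVert B t = Fin (n B) × Fin t

BLess : ∀ B t → Permutation′ (n B) → BVert B t → BVert B t → Set
BLess B t φ (x , j) (y , j') =
  ((φ ⟨$⟩ʳ x) < (φ ⟨$⟩ʳ y)) ⊎ ((x ≡ y) × (j < j'))

BEdge : ∀ {B t} → BVert B t → BVert B t → Set
BEdge {B} (x , _) (y , _) = E (graphOf B) x y

IsCopy : ∀ {h} (H : Graph h) (B : CompleteMultipartite) (t : ℕ)
         (φ : Permutation′ (n B)) → (Fin h → BVert B t) → Set
IsCopy H B t φ f =
  (∀ a b → a < b → BLess B t φ (f a) (f b)) × (∀ a b → E H a b → BEdge {B} {t} (f a) (f b))

HasPerfectTiling : ∀ {h} (H : Graph h) (B : CompleteMultipartite) (t : ℕ)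
                   (φ : Permutation′ (n B)) → Set
HasPerfectTiling {h} H B t φ =
  Σ ℕ λ m → Σ (Fin m → Fin h → BVert B t) λ f →
    (∀ i → IsCopy H B t φ (f i)) ×
    (∀ i j a b → f i a ≡ f j b → (i ≡ j) × (a ≡ b)) ×
    (∀ v → ∃ λ i → ∃ λ a → f i a ≡ v)

IsBottlegraph : ∀ {h} → Graph h → CompleteMultipartite → Set
IsBottlegraph H B =
  ∀ (σ : Permutation′ (k B)) (φ : Permutation′ (n B)) →
    IsIntervalLabelling B σ φ →
    Σ ℕ λ t → HasPerfectTiling H B (suc t) φ

-- "χ_cr(B) ≥ p / q" for χ_cr(B) = (χ(B)-1)|B| / (|B| - σ(B)), written by
-- cross-multiplication:  p (|B| - σ(B)) ≤ q (χ(B)-1)|B|.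
ChiCrAtLeast : CompleteMultipartite → ℕ → ℕ → Set
ChiCrAtLeast B p q =
  ∀ χ s → IsChromaticNumber (graphOf B) χ → IsSigma (graphOf B) χ s →
    p * (n B ∸ s) ≤ q * ((χ ∸ 1) * n B)

-- χ*_cr(H) ≥ p / q  ⇔  every bottlegraph B of H has χ_cr(B) ≥ p / q
-- (unfolding of the infimum)
ChiStarCrAtLeast : ∀ {h} → Graph h → ℕ → ℕ → Set
ChiStarCrAtLeast H p q =
  ∀ B → IsBottlegraph H B → ChiCrAtLeast B p q

-- Let U be a part of a bottlegraph B of H and choose an interval labelling that places U first.  In
-- every copy of H in a perfect tiling of the blow-up, the vertices lying in the blow-up of U form an
-- independent initial segment of H; merging such a segment into the first interval of an optimal
-- interval colouring shows that it has at most ℓ₋(H) vertices.  Double counting over the tiling gives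
-- h|U| ≤ ℓ₋(H)|B| for every part, hence for every colour class of B, and summing the classes other
-- than a smallest one gives h(|B| − σ(B)) ≤ ℓ₋(H)(χ(B) − 1)|B|.  The bound with ℓ*₋(H) is the mirror
-- image: place U last, and read final segments of H as initial segments of its reversal.

module Submission where

open import Defs hiding (sym)
open import Data.Nat using (ℕ; zero; suc; _+_; _*_; _∸_; _≤_; _<_; z≤n; s≤s; s≤s⁻¹)
import Data.Nat.Properties as ℕₚ
open import Data.Nat.Solver using (module +-*-Solver)
open import Data.Fin using (Fin; zero; suc; toℕ; fromℕ; fromℕ<; opposite; punchIn; punchOut; combine; remQuot; inject≤)
import Data.Fin as Fin
import Data.Fin.Properties as Finₚ
open import Data.Fin.Permutation using (Permutation′; _⟨$⟩ʳ_; _⟨$⟩ˡ_; permutation; transpose; inverseˡ)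
open import Data.List using (List; []; _∷_; length; filter; allFin; lookup)
import Data.List.Properties as Listₚ
open import Data.List.Membership.Propositional using (_∈_)
open import Data.List.Membership.Propositional.Properties using (∈-lookup; ∈-filter⁺; ∈-filter⁻; ∈-allFin)
open import Data.List.Relation.Unary.Any using (index)
open import Data.List.Relation.Unary.Any.Properties using (lookup-index)
import Data.List.Relation.Unary.All as All
open import Data.List.Relation.Unary.AllPairs using (_∷_)
open import Data.List.Relation.Unary.Unique.Propositional using (Unique)
import Data.List.Relation.Unary.Unique.Propositional.Properties as Uniqueₚ
open import Algebra.Properties.CommutativeMonoid.Sum ℕₚ.+-0-commutativeMonoid using (sum; sum-remove; sum-cong-≗; sum-replicate-zero)
open import Data.Product using (Σ-syntax; ∃; _×_; _,_; proj₁; proj₂; uncurry)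
open import Data.Sum using (_⊎_; inj₁; inj₂)
open import Data.Empty using (⊥-elim)
open import Function using (_∘_; Injective)
open import Relation.Nullary using (¬_; Dec; yes; no)
open import Relation.Nullary.Decidable using (decidable-stable; dec-true)
open import Relation.Unary using (Pred; Decidable)
open import Relation.Binary.Definitions using (tri<; tri≈; tri>)
open import Relation.Binary.PropositionalEquality
open import Level using (0ℓ)

lookup-injective : ∀ {A : Set} {xs : List A} → Unique xs → Injective _≡_ _≡_ (lookup xs)
lookup-injective {xs = x ∷ xs} (x∉xs ∷ u) {zero}  {zero}  _  = refl
lookup-injective {xs = x ∷ xs} (x∉xs ∷ u) {zero}  {suc j} eq = ⊥-elim (All.lookup x∉xs (∈-lookup j) eq)
lookup-injective {xs = x ∷ xs} (x∉xs ∷ u) {suc i} {zero}  eq = ⊥-elim (All.lookup x∉xs (∈-lookup i) (sym eq))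
lookup-injective {xs = x ∷ xs} (x∉xs ∷ u) {suc i} {suc j} eq = cong suc (lookup-injective u eq)

module Count {N : ℕ} {P : Pred (Fin N) 0ℓ} (P? : Decidable P) where

  elements : List (Fin N)
  elements = filter P? (allFin N)

  count : ℕ
  count = length elements

  enum : Fin count → Fin N
  enum = lookup elements

  enum-injective : Injective _≡_ _≡_ enum
  enum-injective = lookup-injective (Uniqueₚ.filter⁺ P? (Uniqueₚ.allFin⁺ N))

  enum-satisfies : ∀ a → P (enum a)
  enum-satisfies a = proj₂ (∈-filter⁻ P? {xs = allFin N} (∈-lookup a))

  ≤-count : ∀ {A} (g : Fin A → Fin N) → Injective _≡_ _≡_ g → (∀ a → P (g a)) → A ≤ count
  ≤-count g g-injective Pg = Finₚ.injective⇒≤ {f = index ∘ g∈} λ {a} {b} eq → g-injective (begin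
    g a                            ≡⟨ lookup-index (g∈ a) ⟩
    lookup elements (index (g∈ a)) ≡⟨ cong (lookup elements) eq ⟩
    lookup elements (index (g∈ b)) ≡⟨ lookup-index (g∈ b) ⟨
    g b                            ∎)
    where
    open ≡-Reasoning
    g∈ : ∀ a → g a ∈ elements
    g∈ a = ∈-filter⁺ P? (∈-allFin (g a)) (Pg a)

  prefix≤count : ∀ (a : Fin N) → (∀ x → x Fin.≤ a → P x) → suc (toℕ a) ≤ count
  prefix≤count a Pa = ≤-count embed embed-injective (λ b → Pa (embed b) (embed≤a b))
    where
    embed : Fin (suc (toℕ a)) → Fin N
    embed b = inject≤ b (Finₚ.toℕ<n a)
    embed-injective : Injective _≡_ _≡_ embed
    embed-injective = Finₚ.inject≤-injective _ _ _ _
    embed≤a : ∀ b → embed b Fin.≤ a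
    embed≤a b = subst (_≤ toℕ a) (sym (Finₚ.toℕ-inject≤ b _)) (s≤s⁻¹ (Finₚ.toℕ<n b))

  count≡0⊎∃ : count ≡ 0 ⊎ ∃ P
  count≡0⊎∃ with 0 ℕₚ.<? count
  ... | yes 0<count = inj₂ (enum (fromℕ< 0<count) , enum-satisfies _)
  ... | no 0≮count  = inj₁ (ℕₚ.n≤0⇒n≡0 (ℕₚ.≮⇒≥ 0≮count))

-- classSize c i is, definitionally, Class.count c i.
module Class {n k} (c : Fin n → Fin k) (i : ℕ) = Count (λ x → toℕ (c x) ℕₚ.≟ i)

product-injective⇒≤ : ∀ {a b c d} (g : Fin a × Fin b → Fin c × Fin d) → Injective _≡_ _≡_ g → a * b ≤ c * d
product-injective⇒≤ {a} {b} {c} {d} g g-injective =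
  Finₚ.injective⇒≤ {f = uncurry combine ∘ g ∘ remQuot b} λ eq →
    remQuot-injective (g-injective (uncurry (cong₂ _,_) (Finₚ.combine-injective _ _ _ _ eq)))
  where
  remQuot-injective : ∀ {x y} → remQuot {a} b x ≡ remQuot b y → x ≡ y
  remQuot-injective {x} {y} eq = begin
    x                                 ≡⟨ Finₚ.combine-remQuot {a} b x ⟨
    uncurry combine (remQuot {a} b x) ≡⟨ cong (uncurry combine) eq ⟩
    uncurry combine (remQuot {a} b y) ≡⟨ Finₚ.combine-remQuot {a} b y ⟩
    y                                 ∎
    where open ≡-Reasoning

injective⇒surjective : ∀ {N} {f : Fin N → Fin N} → Injective _≡_ _≡_ f → ∀ z → ∃ λ x → f x ≡ z
injective⇒surjective {suc N} {f} f-injective z with Finₚ.any? (λ x → f x Finₚ.≟ z)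
... | yes hit = hit
... | no miss = ⊥-elim (ℕₚ.<-irrefl refl (Finₚ.injective⇒≤ {f = f′} f′-injective))
  where
  z≢f : ∀ x → z ≢ f x
  z≢f x e = miss (x , sym e)
  f′ : Fin (suc N) → Fin N
  f′ x = punchOut (z≢f x)
  f′-injective : Injective _≡_ _≡_ f′
  f′-injective {x} {y} eq = f-injective (Finₚ.punchOut-injective (z≢f x) (z≢f y) eq)

injective⇒permutation : ∀ {N} (f : Fin N → Fin N) → Injective _≡_ _≡_ f → Permutation′ N
injective⇒permutation f f-injective = permutation f (proj₁ ∘ surj) (proj₂ ∘ surj) (λ x → f-injective (proj₂ (surj (f x))))
  where surj = injective⇒surjective f-injective

⟨$⟩ʳ-injective : ∀ {K} (σ : Permutation′ K) → Injective _≡_ _≡_ (σ ⟨$⟩ʳ_)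
⟨$⟩ʳ-injective σ {x} {y} eq = trans (sym (inverseˡ σ)) (trans (cong (σ ⟨$⟩ˡ_) eq) (inverseˡ σ))

transpose-sends : ∀ {K} (j z : Fin K) → transpose j z ⟨$⟩ʳ j ≡ z
transpose-sends j z rewrite dec-true (j Finₚ.≟ j) refl = refl

movedFirst : ∀ {K} (j : Fin K) → Σ[ σ ∈ Permutation′ K ] (∀ (z : Fin K) → σ ⟨$⟩ʳ j Fin.≤ z)
movedFirst {suc K} j = transpose j zero , λ z → subst (λ (w : Fin (suc K)) → w Fin.≤ z) (sym (transpose-sends j zero)) z≤n

movedLast : ∀ {K} (j : Fin K) → Σ[ σ ∈ Permutation′ K ] (∀ (z : Fin K) → z Fin.≤ σ ⟨$⟩ʳ j)
movedLast {suc K} j = transpose j (fromℕ K) , λ z → subst (λ (w : Fin (suc K)) → z Fin.≤ w) (sym (transpose-sends j (fromℕ K))) (Finₚ.≤fromℕ z)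

-- Sorting by an injective key sends x to the number of elements of smaller key.
module Sorting {N M : ℕ} (key : Fin N → Fin M) (key-injective : Injective _≡_ _≡_ key) where

  private
    module Below (x : Fin N) = Count (λ y → key y Finₚ.<? key x)

  rank : Fin N → ℕ
  rank x = Below.count x

  private
    atOrBelow : ∀ x → Fin (suc (rank x)) → Fin N
    atOrBelow x zero    = x
    atOrBelow x (suc p) = Below.enum x p

    atOrBelow-≤ : ∀ x p → key (atOrBelow x p) Fin.≤ key x
    atOrBelow-≤ x zero    = ℕₚ.≤-refl
    atOrBelow-≤ x (suc p) = ℕₚ.<⇒≤ (Below.enum-satisfies x p)

    atOrBelow-injective : ∀ x → Injective _≡_ _≡_ (atOrBelow x)
    atOrBelow-injective x {zero}  {zero}  _  = refl
    atOrBelow-injective x {zero}  {suc q} eq = ⊥-elim (Finₚ.<-irrefl (cong key (sym eq)) (Below.enum-satisfies x q))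
    atOrBelow-injective x {suc p} {zero}  eq = ⊥-elim (Finₚ.<-irrefl (cong key eq) (Below.enum-satisfies x p))
    atOrBelow-injective x {suc p} {suc q} eq = cong suc (Below.enum-injective x eq)

  rank<N : ∀ x → rank x < N
  rank<N x = Finₚ.injective⇒≤ (atOrBelow-injective x)

  rank-monotone : ∀ {x y} → key x Fin.< key y → rank x < rank y
  rank-monotone {x} {y} kx<ky =
    Below.≤-count y (atOrBelow x) (atOrBelow-injective x) (λ p → ℕₚ.≤-<-trans (atOrBelow-≤ x p) kx<ky)

  rank-injective : Injective _≡_ _≡_ rank
  rank-injective {x} {y} eq with Finₚ.<-cmp (key x) (key y)
  ... | tri< kx<ky _ _ = ⊥-elim (ℕₚ.<-irrefl eq (rank-monotone kx<ky))
  ... | tri≈ _ kx≡ky _ = key-injective kx≡ky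
  ... | tri> _ _ ky<kx = ⊥-elim (ℕₚ.<-irrefl (sym eq) (rank-monotone ky<kx))

  sortingPermutation : Permutation′ N
  sortingPermutation = injective⇒permutation (λ x → fromℕ< (rank<N x)) λ {x} {y} eq →
    rank-injective (Finₚ.fromℕ<-injective (rank x) (rank y) (rank<N x) (rank<N y) eq)

  sortingPermutation-monotone : ∀ {x y} → key x Fin.< key y → sortingPermutation ⟨$⟩ʳ x Fin.< sortingPermutation ⟨$⟩ʳ y
  sortingPermutation-monotone {x} {y} kx<ky =
    subst₂ _<_ (sym (Finₚ.toℕ-fromℕ< (rank<N x))) (sym (Finₚ.toℕ-fromℕ< (rank<N y))) (rank-monotone kx<ky)

sum-incrementAt : ∀ {k} (t u : Fin k → ℕ) (y : Fin k) → u y ≡ suc (t y) → (∀ i → y ≢ i → u i ≡ t i) → sum u ≡ suc (sum t)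
sum-incrementAt {suc k} t u y uy≡ u≡t = begin
  sum u                           ≡⟨ sum-remove {i = y} u ⟩
  u y + sum (u ∘ punchIn y)       ≡⟨ cong₂ _+_ uy≡ (sum-cong-≗ λ i → u≡t (punchIn y i) (Finₚ.punchInᵢ≢i y i ∘ sym)) ⟩
  suc (t y + sum (t ∘ punchIn y)) ≡⟨ cong suc (sum-remove {i = y} t) ⟨
  suc (sum t)                     ∎
  where open ≡-Reasoning

sum-filterClasses : ∀ {n k} (c : Fin n → Fin k) (xs : List (Fin n)) →
  sum {k} (λ i → length (filter (λ x → toℕ (c x) ℕₚ.≟ toℕ i) xs)) ≡ length xs
sum-filterClasses {k = k} c [] = sum-replicate-zero k
sum-filterClasses {k = k} c (x ∷ xs) = trans
  (sum-incrementAt {k} _ _ (c x) (cong length (Listₚ.filter-accept (P? (c x)) refl))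
                   (λ i cx≢i → cong length (Listₚ.filter-reject (P? i) (cx≢i ∘ Finₚ.toℕ-injective))))
  (cong suc (sum-filterClasses c xs))
  where
  P? : ∀ i x → Dec (toℕ (c x) ≡ toℕ i)
  P? i x = toℕ (c x) ℕₚ.≟ toℕ i

sum-classSize : ∀ {n k} (c : Fin n → Fin k) → sum {k} (λ i → classSize c (toℕ i)) ≡ n
sum-classSize {n} c = trans (sum-filterClasses c (allFin n)) (Listₚ.length-tabulate (λ x → x))

*-sum-≤ : ∀ {k} (t : Fin k → ℕ) h M → (∀ i → h * t i ≤ M) → h * sum t ≤ k * M
*-sum-≤ {zero}  t h M bound = ℕₚ.≤-reflexive (ℕₚ.*-zeroʳ h)
*-sum-≤ {suc k} t h M bound = begin
  h * (t zero + sum (t ∘ suc))   ≡⟨ ℕₚ.*-distribˡ-+ h (t zero) _ ⟩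
  h * t zero + h * sum (t ∘ suc) ≤⟨ ℕₚ.+-mono-≤ (bound zero) (*-sum-≤ (t ∘ suc) h M (bound ∘ suc)) ⟩
  M + k * M                      ∎
  where open ℕₚ.≤-Reasoning

*-sum-≤-except : ∀ {k} (t : Fin k → ℕ) (i₀ : Fin k) h M → (∀ i → h * t i ≤ M) → h * sum t ≤ h * t i₀ + (k ∸ 1) * M
*-sum-≤-except {suc k} t i₀ h M bound = begin
  h * sum t                                ≡⟨ cong (h *_) (sum-remove {i = i₀} t) ⟩
  h * (t i₀ + sum (t ∘ punchIn i₀))        ≡⟨ ℕₚ.*-distribˡ-+ h (t i₀) _ ⟩
  h * t i₀ + h * sum (t ∘ punchIn i₀)      ≤⟨ ℕₚ.+-monoʳ-≤ (h * t i₀) (*-sum-≤ (t ∘ punchIn i₀) h M (bound ∘ punchIn i₀)) ⟩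
  h * t i₀ + k * M                         ∎
  where open ℕₚ.≤-Reasoning

-- From part sizes to the critical chromatic number

PartsAtMost : CompleteMultipartite → ℕ → ℕ → Set
PartsAtMost B h ℓ = ∀ (j : Fin (k B)) → h * classSize (part B) (toℕ j) ≤ ℓ * n B

colourClass≤part : ∀ B {χ} {c : Fin (n B) → Fin χ} → IsProperColouring (graphOf B) χ c →
  ∀ x → classSize c (toℕ (c x)) ≤ classSize (part B) (toℕ (part B x))
colourClass≤part B {c = c} proper x =
  Class.≤-count (part B) _ (Class.enum c _) (Class.enum-injective c _) λ p →
    cong toℕ (samePart (Class.enum c _ p) (Finₚ.toℕ-injective (Class.enum-satisfies c _ p)))
  where
  samePart : ∀ y → c y ≡ c x → part B y ≡ part B x
  samePart y cy≡cx = decidable-stable (part B y Finₚ.≟ part B x) λ py≢px → proper y x py≢px cy≡cx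

colourClassesAtMost : ∀ {B h ℓ χ} {c : Fin (n B) → Fin χ} → PartsAtMost B h ℓ → IsProperColouring (graphOf B) χ c →
  ∀ (i : Fin χ) → h * classSize c (toℕ i) ≤ ℓ * n B
colourClassesAtMost {B} {h} {ℓ} {c = c} parts proper i with Class.count≡0⊎∃ c (toℕ i)
... | inj₁ empty = subst (λ u → h * u ≤ ℓ * n B) (sym empty) (subst (_≤ ℓ * n B) (sym (ℕₚ.*-zeroʳ h)) z≤n)
... | inj₂ (x , cx≡i) = begin
  h * classSize c (toℕ i)                 ≡⟨ cong (λ u → h * classSize c u) cx≡i ⟨
  h * classSize c (toℕ (c x))             ≤⟨ ℕₚ.*-monoʳ-≤ h (colourClass≤part B proper x) ⟩
  h * classSize (part B) (toℕ (part B x)) ≤⟨ parts (part B x) ⟩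
  ℓ * n B                                 ∎
  where open ℕₚ.≤-Reasoning

-- Only the χ-colouring realising σ(B) is used.
PartsAtMost⇒ChiCrAtLeast : ∀ {B h ℓ} → PartsAtMost B h ℓ → ChiCrAtLeast B h ℓ
PartsAtMost⇒ChiCrAtLeast {B} {h} {ℓ} parts χ s _ ((c , proper , i₀ , |i₀|≡s) , _) = begin
  h * (n B ∸ s)         ≡⟨ ℕₚ.*-distribˡ-∸ h (n B) s ⟩
  h * n B ∸ h * s       ≤⟨ ℕₚ.m≤n+o⇒m∸n≤o (h * n B) (h * s) total ⟩
  (χ ∸ 1) * (ℓ * n B)   ≡⟨ solve 3 (λ a b c → a :* (b :* c) := b :* (a :* c)) refl (χ ∸ 1) ℓ (n B) ⟩
  ℓ * ((χ ∸ 1) * n B)   ∎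
  where
  open ℕₚ.≤-Reasoning
  open +-*-Solver
  total : h * n B ≤ h * s + (χ ∸ 1) * (ℓ * n B)
  total = begin
    h * n B                                        ≡⟨ cong (h *_) (sum-classSize c) ⟨
    h * sum {χ} (λ i → classSize c (toℕ i))        ≤⟨ *-sum-≤-except _ i₀ h (ℓ * n B) (colourClassesAtMost {B} {h} {ℓ} parts proper) ⟩
    h * classSize c (toℕ i₀) + (χ ∸ 1) * (ℓ * n B) ≡⟨ cong (λ u → h * u + (χ ∸ 1) * (ℓ * n B)) |i₀|≡s ⟩
    h * s + (χ ∸ 1) * (ℓ * n B)                    ∎

-- Interval colourings

IsMonotone : ∀ {h r} → (Fin h → Fin r) → Set
IsMonotone c = ∀ x y → x Fin.< y → toℕ (c x) ≤ toℕ (c y)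

IndependentPrefix : ∀ {h} → Graph h → Fin h → Set
IndependentPrefix H a = ∀ b b′ → b Fin.≤ a → b′ Fin.≤ a → ¬ E H b b′

IndependentPrefixesAtMost : ∀ {h} → Graph h → ℕ → Set
IndependentPrefixesAtMost H ℓ = ∀ a → IndependentPrefix H a → suc (toℕ a) ≤ ℓ

removeUnusedColour : ∀ {h} {H : Graph h} {r} (c : Fin h → Fin (suc r)) → IsMonotone c → IsProperColouring H (suc r) c →
  ∀ i → ¬ (∃ λ x → c x ≡ i) → Σ[ c′ ∈ (Fin h → Fin r) ] IsMonotone c′ × IsProperColouring H r c′
removeUnusedColour c c-monotone c-proper i unused =
  (λ x → punchOut (i≢c x)) ,
  (λ x y x<y → Finₚ.punchOut-mono-≤ (i≢c x) (i≢c y) (c-monotone x y x<y)) ,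
  (λ x y e eq → c-proper x y e (Finₚ.punchOut-injective (i≢c x) (i≢c y) eq))
  where
  i≢c : ∀ x → i ≢ c x
  i≢c x e = unused (x , sym e)

onto⊎fewerColours : ∀ {h} {H : Graph h} {r} (c : Fin h → Fin r) → IsMonotone c → IsProperColouring H r c →
  (∀ i → ∃ λ x → c x ≡ i) ⊎ (∃ λ s → s < r × IntervalColouring H s)
onto⊎fewerColours {r = r} c c-monotone c-proper with Finₚ.all? (λ i → Finₚ.any? (λ x → c x Finₚ.≟ i))
... | yes onto = inj₁ onto
... | no ¬onto with Finₚ.¬∀⟶∃¬ r _ (λ i → Finₚ.any? (λ x → c x Finₚ.≟ i)) ¬onto
onto⊎fewerColours {H = H} {r = suc r} c c-monotone c-proper | no _ | (i , unused)
  with removeUnusedColour {H = H} c c-monotone c-proper i unused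
... | c′ , c′-monotone , c′-proper with onto⊎fewerColours c′ c′-monotone c′-proper
...   | inj₁ onto = inj₂ (r , ℕₚ.n<1+n r , record { col = c′ ; monotone = c′-monotone ; onto = onto ; proper = c′-proper })
...   | inj₂ (s , s<r , C) = inj₂ (s , ℕₚ.m<n⇒m<1+n s<r , C)

chromatic⇒onto : ∀ {h} {H : Graph h} {r} → IsIntervalChromatic H r →
  (c : Fin h → Fin r) → IsMonotone c → IsProperColouring H r c → ∀ i → ∃ λ x → c x ≡ i
chromatic⇒onto (_ , minimal) c c-monotone c-proper with onto⊎fewerColours c c-monotone c-proper
... | inj₁ onto = onto
... | inj₂ (s , s<r , C) = ⊥-elim (minimal s s<r C)

toIntervalColouring : ∀ {h} {H : Graph h} {r} → IsIntervalChromatic H r →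
  (c : Fin h → Fin r) → IsMonotone c → IsProperColouring H r c → IntervalColouring H r
toIntervalColouring chromatic c c-monotone c-proper = record
  { col = c ; monotone = c-monotone ; onto = chromatic⇒onto chromatic c c-monotone c-proper ; proper = c-proper }

module MergePrefix {h} {H : Graph h} {r} (c : Fin h → Fin (suc r)) (c-monotone : IsMonotone c)
  (c-proper : IsProperColouring H (suc r) c) (a : Fin h) (independent : IndependentPrefix H a) where

  merged : Fin h → Fin (suc r)
  merged x with x Finₚ.≤? a
  ... | yes _ = zero
  ... | no _  = c x

  merged-prefix : ∀ x → x Fin.≤ a → toℕ (merged x) ≡ 0
  merged-prefix x x≤a with x Finₚ.≤? a
  ... | yes _   = refl
  ... | no x≰a = ⊥-elim (x≰a x≤a)

  merged-monotone : IsMonotone merged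
  merged-monotone x y x<y with x Finₚ.≤? a | y Finₚ.≤? a
  ... | yes _   | yes _   = z≤n
  ... | yes _   | no _    = z≤n
  ... | no x≰a | yes y≤a = ⊥-elim (x≰a (ℕₚ.≤-trans (ℕₚ.<⇒≤ x<y) y≤a))
  ... | no _    | no _    = c-monotone x y x<y

  firstColour-downClosed : ∀ {x y} → x Fin.< y → c y ≡ zero → c x ≡ zero
  firstColour-downClosed {x} {y} x<y cy≡0 =
    Finₚ.toℕ-injective (ℕₚ.n≤0⇒n≡0 (subst (toℕ (c x) ≤_) (cong toℕ cy≡0) (c-monotone x y x<y)))

  merged-proper : IsProperColouring H (suc r) merged
  merged-proper x y e with x Finₚ.≤? a | y Finₚ.≤? a
  ... | yes x≤a | yes y≤a = λ _ → independent x y x≤a y≤a e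
  ... | yes x≤a | no y≰a  = λ 0≡cy →
    c-proper x y e (trans (firstColour-downClosed (ℕₚ.≤-<-trans x≤a (ℕₚ.≰⇒> y≰a)) (sym 0≡cy)) 0≡cy)
  ... | no x≰a  | yes y≤a = λ cx≡0 →
    c-proper y x (Graph.sym H e) (trans (firstColour-downClosed (ℕₚ.≤-<-trans y≤a (ℕₚ.≰⇒> x≰a)) cx≡0) (sym cx≡0))
  ... | no _    | no _    = c-proper x y e

prefixBound : ∀ {h} {H : Graph h} {r ℓ} → IsIntervalChromatic H r →
  (∀ (c : IntervalColouring H r) → firstSize c ≤ ℓ) → IndependentPrefixesAtMost H ℓ
prefixBound {r = zero}  (c₀ , _) _ a _ = ⊥-elim (Finₚ.¬Fin0 (col c₀ a))
prefixBound {H = H} {r = suc r} chromatic@(c₀ , _) firstSizes≤ℓ a independent = ℕₚ.≤-trans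
  (Class.prefix≤count merged 0 a merged-prefix)
  (firstSizes≤ℓ (toIntervalColouring chromatic merged merged-monotone merged-proper))
  where open MergePrefix {H = H} (col c₀) (monotone c₀) (proper c₀) a independent

opposite-injective : ∀ {h} → Injective _≡_ _≡_ (opposite {h})
opposite-injective {x = x} {y} eq =
  trans (sym (Finₚ.opposite-involutive x)) (trans (cong opposite eq) (Finₚ.opposite-involutive y))

opposite-antitone : ∀ {h} {x y : Fin h} → x Fin.≤ y → opposite y Fin.≤ opposite x
opposite-antitone {h} {x} {y} x≤y = subst₂ _≤_ (sym (Finₚ.opposite-prop y)) (sym (Finₚ.opposite-prop x))
  (ℕₚ.∸-monoʳ-≤ h (s≤s x≤y))

opposite-antitone-< : ∀ {h} {x y : Fin h} → x Fin.< y → opposite y Fin.< opposite x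
opposite-antitone-< x<y = Finₚ.≤∧≢⇒< (opposite-antitone (ℕₚ.<⇒≤ x<y)) λ eq → Finₚ.<⇒≢ x<y (opposite-injective (sym eq))

≤opposite⇒≤opposite : ∀ {h} {x y : Fin h} → x Fin.≤ opposite y → y Fin.≤ opposite x
≤opposite⇒≤opposite {y = y} x≤y′ = subst (Fin._≤ _) (Finₚ.opposite-involutive y) (opposite-antitone x≤y′)

reverse : ∀ {h} → Graph h → Graph h
reverse H = record
  { E      = λ x y → E H (opposite x) (opposite y)
  ; sym    = Graph.sym H
  ; irrefl = irrefl H
  }

mirror : ∀ {h r} → (Fin h → Fin r) → Fin h → Fin r
mirror c = opposite ∘ c ∘ opposite

mirrorColouring : ∀ {h} {H H′ : Graph h} {r} → (∀ {x y} → E H′ x y → E H (opposite x) (opposite y)) →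
  IntervalColouring H r → IntervalColouring H′ r
mirrorColouring {H′ = H′} {r} edges C = record
  { col      = mirror (col C)
  ; monotone = λ x y x<y → opposite-antitone (monotone C _ _ (opposite-antitone-< x<y))
  ; onto     = λ i → let (x , cx≡) = onto C (opposite i) in
      opposite x , (begin
        opposite (col C (opposite (opposite x))) ≡⟨ cong (opposite ∘ col C) (Finₚ.opposite-involutive x) ⟩
        opposite (col C x)                       ≡⟨ cong opposite cx≡ ⟩
        opposite (opposite i)                    ≡⟨ Finₚ.opposite-involutive i ⟩
        i                                        ∎)
  ; proper   = λ x y e eq → proper C _ _ (edges e) (opposite-injective eq)
  }
  where open ≡-Reasoning

firstSize≤lastSize-mirror : ∀ {h r} (c : Fin h → Fin r) → classSize c 0 ≤ classSize (mirror c) (r ∸ 1)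
firstSize≤lastSize-mirror {r = r} c = Class.≤-count (mirror c) (r ∸ 1) (opposite ∘ Class.enum c 0)
  (Class.enum-injective c 0 ∘ opposite-injective) λ p → let x = Class.enum c 0 p in begin
    toℕ (opposite (c (opposite (opposite x)))) ≡⟨ cong (toℕ ∘ opposite ∘ c) (Finₚ.opposite-involutive x) ⟩
    toℕ (opposite (c x))                       ≡⟨ Finₚ.opposite-prop (c x) ⟩
    r ∸ suc (toℕ (c x))                        ≡⟨ cong (λ i → r ∸ suc i) (Class.enum-satisfies c 0 p) ⟩
    r ∸ 1                                      ∎
  where open ≡-Reasoning

suffixBound : ∀ {h} {H : Graph h} {r ℓ} → IsIntervalChromatic H r →
  (∀ (c : IntervalColouring H r) → lastSize c ≤ ℓ) → IndependentPrefixesAtMost (reverse H) ℓ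
suffixBound {H = H} (c₀ , minimal) lastSizes≤ℓ = prefixBound {H = reverse H}
  (mirrorColouring (λ e → e) c₀ , λ s s<r C → minimal s s<r (mirrorColouring unreverse C))
  (λ c → ℕₚ.≤-trans (firstSize≤lastSize-mirror (col c)) (lastSizes≤ℓ (mirrorColouring unreverse c)))
  where
  unreverse : ∀ {x y} → E H x y → E (reverse H) (opposite x) (opposite y)
  unreverse = subst₂ (E H) (sym (Finₚ.opposite-involutive _)) (sym (Finₚ.opposite-involutive _))

-- Copies of H in ordered blow-ups

intervalLabelling : ∀ B (σ : Permutation′ (k B)) → Σ[ φ ∈ Permutation′ (n B) ] IsIntervalLabelling B σ φ
intervalLabelling B σ =
  sortingPermutation , λ x y σx<σy → sortingPermutation-monotone (Finₚ.combine-monoˡ-< x y σx<σy)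
  where
  -- lexicographic in (σ-position of the part, vertex)
  key : Fin (n B) → Fin (k B * n B)
  key x = combine (σ ⟨$⟩ʳ part B x) x
  open Sorting key (λ {x} {y} → Finₚ.combine-injectiveʳ (σ ⟨$⟩ʳ part B x) x (σ ⟨$⟩ʳ part B y) y)

module CopyInBlowUp {h} {H : Graph h} {B : CompleteMultipartite} {σ : Permutation′ (k B)} {t}
  {φ : Permutation′ (n B)} (labelling : IsIntervalLabelling B σ φ)
  {f : Fin h → BVert B t} (copy : IsCopy H B t φ f) where

  partOf : Fin h → Fin (k B)
  partOf a = part B (proj₁ (f a))

  partOf-monotone : ∀ {a b} → a Fin.≤ b → σ ⟨$⟩ʳ partOf a Fin.≤ σ ⟨$⟩ʳ partOf b
  partOf-monotone {a} {b} a≤b with a Finₚ.≟ b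
  ... | yes refl = ℕₚ.≤-refl
  ... | no a≢b with proj₁ copy a b (Finₚ.≤∧≢⇒< a≤b a≢b)
  ...   | inj₁ φa<φb = ℕₚ.≮⇒≥ λ σb<σa → Finₚ.<-asym φa<φb (labelling _ _ σb<σa)
  ...   | inj₂ (same , _) = ℕₚ.≤-reflexive (cong (λ x → toℕ (σ ⟨$⟩ʳ part B x)) same)

  samePart⇒nonadjacent : ∀ {a b} → partOf a ≡ partOf b → ¬ E H a b
  samePart⇒nonadjacent eq e = proj₂ copy _ _ e eq

  firstPart-downClosed : ∀ {j a b} → (∀ z → σ ⟨$⟩ʳ j Fin.≤ z) → a Fin.≤ b → partOf b ≡ j → partOf a ≡ j
  firstPart-downClosed {j} {a} least a≤b refl =
    ⟨$⟩ʳ-injective σ (Finₚ.≤-antisym (partOf-monotone a≤b) (least (σ ⟨$⟩ʳ partOf a)))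

  lastPart-upClosed : ∀ {j a b} → (∀ z → z Fin.≤ σ ⟨$⟩ʳ j) → a Fin.≤ b → partOf a ≡ j → partOf b ≡ j
  lastPart-upClosed {j} {a} {b} greatest a≤b refl =
    ⟨$⟩ʳ-injective σ (Finₚ.≤-antisym (greatest (σ ⟨$⟩ʳ partOf b)) (partOf-monotone a≤b))

ratio-bound : ∀ {m h n t u ℓ} → m * h ≤ n * suc t → u * suc t ≤ m * ℓ → h * u ≤ ℓ * n
ratio-bound {m} {h} {n} {t} {u} {ℓ} mh≤nT uT≤mℓ = ℕₚ.*-cancelʳ-≤ (h * u) (ℓ * n) (suc t) (begin
  h * u * suc t    ≡⟨ ℕₚ.*-assoc h u (suc t) ⟩
  h * (u * suc t)  ≤⟨ ℕₚ.*-monoʳ-≤ h uT≤mℓ ⟩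
  h * (m * ℓ)      ≡⟨ solve 3 (λ h m ℓ → h :* (m :* ℓ) := ℓ :* (m :* h)) refl h m ℓ ⟩
  ℓ * (m * h)      ≤⟨ ℕₚ.*-monoʳ-≤ ℓ mh≤nT ⟩
  ℓ * (n * suc t)  ≡⟨ ℕₚ.*-assoc ℓ n (suc t) ⟨
  ℓ * n * suc t    ∎)
  where
  open ℕₚ.≤-Reasoning
  open +-*-Solver

-- The m copies of a perfect tiling are disjoint, so m h ≤ |B| T; every vertex of V(U_j) lies in a
-- copy, and a copy meets V(U_j) in at most ℓ vertices (those a with g a < ℓ), so |U_j| T ≤ m ℓ.
tiling-partBound : ∀ {h} {H : Graph h} {B t φ ℓ} → HasPerfectTiling H B (suc t) φ →
  ∀ (j : Fin (k B)) (g : Fin h → ℕ) → Injective _≡_ _≡_ g →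
  (∀ f → IsCopy H B (suc t) φ f → ∀ a → part B (proj₁ (f a)) ≡ j → g a < ℓ) →
  h * classSize (part B) (toℕ j) ≤ ℓ * n B
tiling-partBound {h} {H} {B} {t} {φ} {ℓ} (m , f , copies , disjoint , covers) j g g-injective bounded =
  ratio-bound {m} {h} {n B} {t} {U.count} {ℓ} (product-injective⇒≤ tile tile-injective) (product-injective⇒≤ slot slot-injective)
  where
  module U = Class (part B) (toℕ j)

  tile : Fin m × Fin h → BVert B (suc t)
  tile (i , a) = f i a

  tile-injective : Injective _≡_ _≡_ tile
  tile-injective eq = let (i≡ , a≡) = disjoint _ _ _ _ eq in cong₂ _,_ i≡ a≡

  vertex : Fin U.count × Fin (suc t) → BVert B (suc t)
  vertex (p , s) = U.enum p , s

  copyOf : Fin U.count × Fin (suc t) → Fin m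
  copyOf x = proj₁ (covers (vertex x))

  preimage : Fin U.count × Fin (suc t) → Fin h
  preimage x = proj₁ (proj₂ (covers (vertex x)))

  preimage-correct : ∀ x → f (copyOf x) (preimage x) ≡ vertex x
  preimage-correct x = proj₂ (proj₂ (covers (vertex x)))

  inPart : ∀ x → part B (proj₁ (f (copyOf x) (preimage x))) ≡ j
  inPart x = trans (cong (part B ∘ proj₁) (preimage-correct x)) (Finₚ.toℕ-injective (U.enum-satisfies (proj₁ x)))

  slot : Fin U.count × Fin (suc t) → Fin m × Fin ℓ
  slot x = copyOf x , fromℕ< (bounded (f (copyOf x)) (copies (copyOf x)) (preimage x) (inPart x))

  slot-injective : Injective _≡_ _≡_ slot
  slot-injective {x} {y} eq = cong₂ _,_ (U.enum-injective (cong proj₁ sameVertex)) (cong proj₂ sameVertex)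
    where
    open ≡-Reasoning
    samePreimage : preimage x ≡ preimage y
    samePreimage = g-injective (Finₚ.fromℕ<-injective _ _ _ _ (cong proj₂ eq))
    sameVertex : vertex x ≡ vertex y
    sameVertex = begin
      vertex x                           ≡⟨ preimage-correct x ⟨
      f (copyOf x) (preimage x)          ≡⟨ cong₂ f (cong proj₁ eq) samePreimage ⟩
      f (copyOf y) (preimage y)          ≡⟨ preimage-correct y ⟩
      vertex y                           ∎

bottlegraph-partBound : ∀ {h} {H : Graph h} {B ℓ} → IsBottlegraph H B →
  ∀ (j : Fin (k B)) (σ : Permutation′ (k B)) (g : Fin h → ℕ) → Injective _≡_ _≡_ g →
  (∀ {t φ} → IsIntervalLabelling B σ φ → ∀ f → IsCopy H B t φ f → ∀ a → part B (proj₁ (f a)) ≡ j → g a < ℓ) →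
  h * classSize (part B) (toℕ j) ≤ ℓ * n B
bottlegraph-partBound {H = H} {B} {ℓ} bottlegraph j σ g g-injective bounded =
  let (φ , labelling) = intervalLabelling B σ
      (t , tiling)    = bottlegraph σ φ labelling
  in tiling-partBound {H = H} {B} {t} {φ} {ℓ} tiling j g g-injective (bounded {suc t} {φ} labelling)

prefixBound⇒PartsAtMost : ∀ {h} {H : Graph h} {B ℓ} → IndependentPrefixesAtMost H ℓ → IsBottlegraph H B →
  PartsAtMost B h ℓ
prefixBound⇒PartsAtMost {H = H} {B} {ℓ} prefixes bottlegraph j =
  let (σ , least) = movedFirst j in
  bottlegraph-partBound {H = H} {B} {ℓ} bottlegraph j σ toℕ Finₚ.toℕ-injective λ {t} {φ} labelling f copy a a∈Uj →
    let open CopyInBlowUp {H = H} {B} {σ} {t} {φ} labelling {f} copy in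
    prefixes a λ b b′ b≤a b′≤a → samePart⇒nonadjacent
      (trans (firstPart-downClosed least b≤a a∈Uj) (sym (firstPart-downClosed least b′≤a a∈Uj)))

-- With U_j last, a copy meets V(U_j) in an independent suffix of H, i.e. a prefix of reverse H.
suffixBound⇒PartsAtMost : ∀ {h} {H : Graph h} {B ℓ} → IndependentPrefixesAtMost (reverse H) ℓ → IsBottlegraph H B →
  PartsAtMost B h ℓ
suffixBound⇒PartsAtMost {H = H} {B} {ℓ} suffixes bottlegraph j =
  let (σ , greatest) = movedLast j in
  bottlegraph-partBound {H = H} {B} {ℓ} bottlegraph j σ (toℕ ∘ opposite) (opposite-injective ∘ Finₚ.toℕ-injective)
    λ {t} {φ} labelling f copy a a∈Uj →
      let open CopyInBlowUp {H = H} {B} {σ} {t} {φ} labelling {f} copy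
          up : ∀ {b} → b Fin.≤ opposite a → partOf (opposite b) ≡ _
          up b≤a′ = lastPart-upClosed greatest (≤opposite⇒≤opposite b≤a′) a∈Uj
      in suffixes (opposite a) λ b b′ b≤a′ b′≤a′ → samePart⇒nonadjacent (trans (up b≤a′) (sym (up b′≤a′)))

proposition11p1 : ∀ (h : ℕ) (H : Graph h) →
    (∀ ℓ → IsEllMinus H ℓ → ChiStarCrAtLeast H h ℓ) ×
    (∀ ℓ → IsEllMinusStar H ℓ → ChiStarCrAtLeast H h ℓ)
proposition11p1 h H =
  (λ ℓ (r , chromatic , _ , firstSizes≤ℓ) B bottlegraph →
     PartsAtMost⇒ChiCrAtLeast {B} {h} {ℓ} (prefixBound⇒PartsAtMost {H = H} {B} {ℓ} (prefixBound chromatic firstSizes≤ℓ) bottlegraph)) ,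
  (λ ℓ (r , chromatic , _ , lastSizes≤ℓ) B bottlegraph →
     PartsAtMost⇒ChiCrAtLeast {B} {h} {ℓ} (suffixBound⇒PartsAtMost {H = H} {B} {ℓ} (suffixBound chromatic lastSizes≤ℓ) bottlegraph))
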